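{- Let $\varphi=\langle X,Q,D,C\rangle$ be a QCSP with $C=\{c_1,\dots,c_m\}$, and for $k\in\{1,\dots,m\}$ let $\varphi_k=\langle X,Q,D,\{c_k\}\rangle$. Then for all $x_i\in X$, $V\subseteq X$ and $a,b\in D_{x_i}$: $\big(\bigvee_{k}\mathit{inconsistent}^{\varphi_k}(x_i,a)\big)\rightarrow\mathit{inconsistent}^{\varphi}(x_i,a)$; $\big(\bigvee_{k}\mathit{implied}^{\varphi_k}(x_i,a)\big)\rightarrow\mathit{implied}^{\varphi}(x_i,a)$; $\big(\bigwedge_{k}\mathit{d\text{ - }fixable}^{\varphi_k}(x_i,a)\big)\rightarrow\mathit{d\text{ - }fixable}^{\varphi}(x_i,a)$; $\big(\bigwedge_{k}\mathit{d\text{ - }substitutable}^{\varphi_k}(x_i,a,b)\big)\rightarrow\mathit{d\text{ - }substitutable}^{\varphi}(x_i,a,b)$; $\big(\bigwedge_{k}\mathit{d\text{ - }interchangeable}^{\varphi_k}(x_i,a,b)\big)\rightarrow\mathit{d\text{ - }interchangeable}^{\varphi}(x_i,a,b)$; $\big(\bigvee_{k}\mathit{determined}^{\varphi_k}(x_i)\big)\rightarrow\mathit{determined}^{\varphi}(x_i)$; $\big(\bigwedge_{k}\mathit{d\text{ - }irrelevant}^{\varphi_k}(x_i)\big)\rightarrow\mathit{d\text{ - }irrelevant}^{\varphi}(x_i)$; $\big(\bigvee_{k}\mathit{dependent}^{\varphi_k}(V,x_i)\big)\rightarrow\mathit{dependent}^{\varphi}(V,x_i)$.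
   Context: Fix a finite set $\mathbb{D}$. For a finite set $V$ of variables, a $V$-tuple is a map $t:V\to\mathbb{D}$ (value at $x$ written $t_x$), and a $V$-relation is a set of $V$-tuples. A QCSP is a tuple $\varphi=\langle X,Q,D,C\rangle$ where $X=\{x_1,\dots,x_n\}$ is a finite set of variables linearly ordered by index, $Q$ assigns to each $x_i$ a quantifier $Q_{x_i}\in\{\forall,\exists\}$, $D$ assigns to each $x_i$ a domain $D_{x_i}\subseteq\mathbb{D}$, and $C$ is a finite set of constraints, each a $V$-relation for some $V\subseteq X$. For a $V$-tuple $t$ and $U\subseteq V$, $t|_U$ is its restriction; for an $X$-tuple $t$, $t[x:=a]$ is $t$ with its value at $x$ changed to $a$. $\mathsf{sol}^\varphi$ is the set of $X$-tuples $t$ with $t|_V\in c$ for all $V$-relations $c\in C$. $\prod_{y\in V}D_y$ is the set of $V$-tuples $t$ with $t_y\in D_y$ for all $y$. Let $E=\{x_i:Q_{x_i}=\exists\}$, $A=\{x_i:Q_{x_i}=\forall\}$, $A_j=\{x_i\in A:i\le j\}$. A strategy is a family $s=(s_{x_i})_{x_i\in E}$ of functions $s_{x_i}:\prod_{y\in A_{i-1}}D_y\to D_{x_i}$; its scenarios $\mathsf{sce}^\varphi(s)$ are the $t\in\prod_{x\in X}D_x$ with $t_{x_i}=s_{x_i}(t|_{A_{i-1}})$ for all $x_i\in E$; $s$ is winning if $\mathsf{sce}^\varphi(s)\subseteq\mathsf{sol}^\varphi$; the outcomes are $\mathsf{out}^\varphi=\bigcup_{s\text{ winning}}\mathsf{sce}^\varphi(s)$.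 Deep properties (with $\mathsf{out}=\mathsf{out}^\varphi$; the superscript indicates the QCSP with respect to which they are evaluated): $\mathit{inconsistent}(x_i,a)\equiv\forall t\in\mathsf{out}.\ t_{x_i}\ne a$; $\mathit{implied}(x_i,a)\equiv\forall t\in\mathsf{out}.\ t_{x_i}=a$; $\mathit{d\text{ - }fixable}(x_i,a)\equiv\forall t\in\mathsf{out}.\ t[x_i:=a]\in\mathsf{out}$; $\mathit{d\text{ - }substitutable}(x_i,a,b)\equiv\forall t\in\mathsf{out}.\ (t_{x_i}=a)\rightarrow(t[x_i:=b]\in\mathsf{out})$; $\mathit{d\text{ - }interchangeable}(x_i,a,b)\equiv\mathit{d\text{ - }substitutable}(x_i,a,b)\wedge\mathit{d\text{ - }substitutable}(x_i,b,a)$; $\mathit{determined}(x_i)\equiv\forall t\in\mathsf{out}.\ \forall b\ne t_{x_i}.\ t[x_i:=b]\notin\mathsf{out}$; $\mathit{d\text{ - }irrelevant}(x_i)\equiv\forall t\in\mathsf{out}.\ \forall b\in D_{x_i}.\ t[x_i:=b]\in\mathsf{out}$; $\mathit{dependent}(V,x_i)\equiv\forall t,t'\in\mathsf{out}.\ (t|_V=t'|_V)\rightarrow(t_{x_i}=t'_{x_i})$. -}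

module Defs where

open import Data.Nat using (ℕ; _<ᵇ_)
open import Data.Bool using (Bool; true; false; _∧_)
open import Data.Fin using (Fin; toℕ)
open import Data.Fin.Subset using (Subset; Side; inside; outside; _∈_)
open import Data.Vec using (Vec; lookup; zipWith; tabulate; _[_]≔_)
open import Data.Maybe using (Maybe; just; nothing)
open import Data.Product using (Σ; _×_)
open import Relation.Binary.PropositionalEquality using (_≡_)
open import Relation.Nullary using (¬_)

-- The fixed finite set 𝔻 is Fin d; the variables x₁ … xₙ are Fin n
-- (linearly ordered by index).

data Quant : Set where
  ∀q ∃q : Quant

Tuple : ℕ → ℕ → Set
Tuple d n = Vec (Fin d) n

-- V-tuples (V ⊆ X) encoded canonically as partial maps:
-- entry x is  just (t x)  for x ∈ V and  nothing  for x ∉ V.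
PTuple : ℕ → ℕ → Set
PTuple d n = Vec (Maybe (Fin d)) n

restrict : ∀ {d n} → Subset n → Tuple d n → PTuple d n
restrict {d} V t = zipWith f V t
  where
  f : Side → Fin d → Maybe (Fin d)
  f inside a = just a
  f outside a = nothing

_[_:=_] : ∀ {d n} → Tuple d n → Fin n → Fin d → Tuple d n
t [ x := a ] = t [ x ]≔ a

record Constraint (d n : ℕ) : Set₁ where
  field
    scope : Subset n
    rel   : PTuple d n → Set

record QCSP (d n : ℕ) : Set₁ where
  field
    Q : Fin n → Quant
    D : Fin n → Subset d
    m : ℕ
    C : Fin m → Constraint d n

module _ {d n : ℕ} (φ : QCSP d n) where
  open QCSP φ
  open Constraint

  sol : Tuple d n → Set
  sol t = (k : Fin m) → rel (C k) (restrict (scope (C k)) t)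

  InDom : Tuple d n → Set
  InDom t = (x : Fin n) → lookup t x ∈ D x

  isForall : Quant → Bool
  isForall ∀q = true
  isForall ∃q = false

  side : Bool → Side
  side true = inside
  side false = outside

  Aprev : Fin n → Subset n
  Aprev i = tabulate (λ y → side (isForall (Q y) ∧ (toℕ y <ᵇ toℕ i)))

  -- A strategy: for each existential x_i a map  s_{x_i} : ∏_{y∈A_{i-1}} D_y → D_{x_i},
  -- represented as a map on full domain tuples that depends only on t|_{A_{i-1}}.
  record Strategy : Set where
    field
      s      : (i : Fin n) → Q i ≡ ∃q → Tuple d n → Fin d
      s-dom  : ∀ i (e : Q i ≡ ∃q) t → InDom t → s i e t ∈ D i
      s-fact : ∀ i (e : Q i ≡ ∃q) t t' → InDom t → InDom t' →
               restrict (Aprev i) t ≡ restrict (Aprev i) t' → s i e t ≡ s i e t'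

  open Strategy

  Scenario : Strategy → Tuple d n → Set
  Scenario σ t = InDom t × ((i : Fin n) (e : Q i ≡ ∃q) → lookup t i ≡ s σ i e t)

  Winning : Strategy → Set
  Winning σ = (t : Tuple d n) → Scenario σ t → sol t

  out : Tuple d n → Set
  out t = Σ Strategy (λ σ → Winning σ × Scenario σ t)

  inconsistent : Fin n → Fin d → Set
  inconsistent x a = ∀ t → out t → ¬ (lookup t x ≡ a)

  implied : Fin n → Fin d → Set
  implied x a = ∀ t → out t → lookup t x ≡ a

  d-fixable : Fin n → Fin d → Set
  d-fixable x a = ∀ t → out t → out (t [ x := a ])

  d-substitutable : Fin n → Fin d → Fin d → Set
  d-substitutable x a b = ∀ t → out t → lookup t x ≡ a → out (t [ x := b ])

  d-interchangeable : Fin n → Fin d → Fin d → Set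
  d-interchangeable x a b = d-substitutable x a b × d-substitutable x b a

  determined : Fin n → Set
  determined x = ∀ t → out t → ∀ (b : Fin d) → ¬ (b ≡ lookup t x) → ¬ out (t [ x := b ])

  d-irrelevant : Fin n → Set
  d-irrelevant x = ∀ t → out t → ∀ (b : Fin d) → b ∈ D x → out (t [ x := b ])

  dependent : Subset n → Fin n → Set
  dependent V x = ∀ t t' → out t → out t' → restrict V t ≡ restrict V t' → lookup t x ≡ lookup t' x

single : ∀ {d n} (φ : QCSP d n) → Fin (QCSP.m φ) → QCSP d n
single φ k = record { Q = QCSP.Q φ ; D = QCSP.D φ ; m = 1 ; C = λ _ → QCSP.C φ k }

module Submission where

-- Every winning strategy of φ also wins φ_k, so out(φ) ⊆ out(φ_k).  The four
-- "disjunctive" properties (inconsistent, implied, determined, dependent) are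
-- universal statements about outcomes and therefore pass to the smaller set
-- out(φ) directly.  The "conjunctive" ones (fixable, substitutable,
-- interchangeable, irrelevant) all reduce to substitutability, which rests on a
-- substitution principle: if replacing c by e at x turns every outcome with
-- value c at x into a solution, then it turns it into an outcome.  Its proof
-- repairs a winning strategy σ at x: for existential x the choice c is replaced
-- by e; for universal x the strategy answers a move e of the adversary as it
-- would have answered c.

open import Defs
open import Data.Nat using (ℕ)
open import Data.Bool using (_∧_)
open import Data.Fin using (Fin; zero; suc; _≟_)
open import Data.Fin.Subset using (Subset; Side; inside; outside; _∈_)
open import Data.Vec using (Vec; []; _∷_; lookup; zipWith; _[_]≔_)
open import Data.Vec.Properties
  using (∷-injectiveˡ; ∷-injectiveʳ; lookup∘update; lookup∘update′; []≔-idempotent; []≔-lookup; lookup∘tabulate)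
open import Data.Maybe using (Maybe; just; nothing)
open import Data.Maybe.Properties using (just-injective)
open import Data.Product using (Σ; _×_; _,_; proj₁; proj₂)
open import Data.Sum using (_⊎_; inj₁; inj₂)
open import Relation.Binary.PropositionalEquality
open import Relation.Nullary using (¬_; Dec; yes; no; contradiction)
open import Axiom.UniquenessOfIdentityProofs.WithK using (uip)

update-restore : ∀ {d n} (t : Tuple d n) x {v} w → lookup t x ≡ v → (t [ x := w ]) [ x := v ] ≡ t
update-restore t x w refl = trans ([]≔-idempotent t x) ([]≔-lookup t x)

-- The component map of 'restrict', at top level so restrictions unfold componentwise.
mark : ∀ {d} → Side → Fin d → Maybe (Fin d)
mark inside a = just a
mark outside a = nothing

zipWith-cong : ∀ {A B C : Set} {n} {f g : A → B → C} → (∀ a b → f a b ≡ g a b) →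
  (as : Vec A n) (bs : Vec B n) → zipWith f as bs ≡ zipWith g as bs
zipWith-cong f≡g [] [] = refl
zipWith-cong f≡g (a ∷ as) (b ∷ bs) = cong₂ _∷_ (f≡g a b) (zipWith-cong f≡g as bs)

-- 'restrict' is zipWith of 'mark' (its own combining function depends on W and t).
restrict-marks : ∀ {d n} (W : Subset n) (t : Tuple d n) → restrict W t ≡ zipWith mark W t
restrict-marks W t = zipWith-cong (λ { inside a → refl ; outside a → refl }) W t

restrict-update-outside : ∀ {d n} (W : Subset n) (t : Tuple d n) x v →
  lookup W x ≡ outside → restrict W (t [ x := v ]) ≡ restrict W t
restrict-update-outside W t x v o
  rewrite restrict-marks W (t [ x := v ]) | restrict-marks W t = marks W t x v o
  where
  marks : ∀ {n} (W : Subset n) (t : Tuple _ n) x v →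
    lookup W x ≡ outside → zipWith mark W (t [ x := v ]) ≡ zipWith mark W t
  marks (outside ∷ W) (a ∷ t) zero v _ = refl
  marks (s ∷ W) (a ∷ t) (suc x) v o = cong (_ ∷_) (marks W t x v o)

-- Recomputing the value at x from the value at x itself respects restrictions:
-- either x ∉ W and nothing visible changes, or x ∈ W and both tuples agree at x.
restrict-update-local : ∀ {d n} (W : Subset n) (t t' : Tuple d n) x (f : Fin d → Fin d) →
  restrict W t ≡ restrict W t' →
  restrict W (t [ x := f (lookup t x) ]) ≡ restrict W (t' [ x := f (lookup t' x) ])
restrict-update-local W t t' x f r
  rewrite restrict-marks W (t [ x := f (lookup t x) ]) | restrict-marks W (t' [ x := f (lookup t' x) ])
        | restrict-marks W t | restrict-marks W t' = marks W t t' x r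
  where
  marks : ∀ {n} (W : Subset n) (t t' : Tuple _ n) x → zipWith mark W t ≡ zipWith mark W t' →
    zipWith mark W (t [ x := f (lookup t x) ]) ≡ zipWith mark W (t' [ x := f (lookup t' x) ])
  marks (inside ∷ W) (a ∷ t) (a' ∷ t') zero r with just-injective (∷-injectiveˡ r)
  ... | refl = cong (_ ∷_) (∷-injectiveʳ r)
  marks (outside ∷ W) (a ∷ t) (a' ∷ t') zero r = cong (_ ∷_) (∷-injectiveʳ r)
  marks (s ∷ W) (a ∷ t) (a' ∷ t') (suc x) r = cong₂ _∷_ (∷-injectiveˡ r) (marks W t t' x (∷-injectiveʳ r))

replace : ∀ {d} → Fin d → Fin d → Fin d → Fin d
replace p q v with v ≟ p
... | yes _ = q
... | no _ = v

replace-hit : ∀ {d} (p q : Fin d) → replace p q p ≡ q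
replace-hit p q with p ≟ p
... | yes _ = refl
... | no p≢p = contradiction refl p≢p

replace-miss : ∀ {d} {p v : Fin d} q → ¬ v ≡ p → replace p q v ≡ v
replace-miss {p = p} {v} q v≢p with v ≟ p
... | yes v≡p = contradiction v≡p v≢p
... | no _ = refl

replace-∈ : ∀ {d} {S : Subset d} p {q v} → v ∈ S → q ∈ S → replace p q v ∈ S
replace-∈ p {v = v} v∈S q∈S with v ≟ p
... | yes _ = q∈S
... | no _ = v∈S

module _ {d n : ℕ} (φ : QCSP d n) where
  open QCSP φ
  open Strategy

  InDom-update : ∀ t x {v} → InDom φ t → v ∈ D x → InDom φ (t [ x := v ])
  InDom-update t x {v} t∈D v∈D y with y ≟ x
  ... | yes refl = subst (_∈ D x) (sym (lookup∘update x t v)) v∈D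
  ... | no y≢x = subst (_∈ D y) (sym (lookup∘update′ y≢x t v)) (t∈D y)

  existential-unobserved : ∀ {x} → Q x ≡ ∃q → ∀ i → lookup (Aprev φ i) x ≡ outside
  existential-unobserved {x} ∃x i =
    trans (lookup∘tabulate _ x) (cong (λ q → side φ (isForall φ q ∧ _)) ∃x)

  choice-ignores : (σ : Strategy φ) {x : Fin n} → Q x ≡ ∃q → ∀ i ei {t v} → InDom φ t → v ∈ D x →
    s σ i ei (t [ x := v ]) ≡ s σ i ei t
  choice-ignores σ {x} ∃x i ei {t} {v} t∈D v∈D =
    s-fact σ i ei _ t (InDom-update t x t∈D v∈D) t∈D (restrict-update-outside (Aprev φ i) t x v (existential-unobserved ∃x i))

  record FollowsOff (σ : Strategy φ) (x : Fin n) (t : Tuple d n) : Set where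
    constructor following
    field
      in-domain : InDom φ t
      obeys : ∀ i ei → ¬ i ≡ x → lookup t i ≡ s σ i ei t

  scenario-follows : ∀ {σ x t} → Scenario φ σ t → FollowsOff σ x t
  scenario-follows (t∈D , follows) = following t∈D λ i ei _ → follows i ei

  complete-scenario : ∀ {σ x t} → FollowsOff σ x t → (∀ ex → lookup t x ≡ s σ x ex t) → Scenario φ σ t
  complete-scenario {σ} {x} {t} (following t∈D follows) at-x = t∈D , case-x
    where
    case-x : (i : Fin n) (ei : Q i ≡ ∃q) → lookup t i ≡ s σ i ei t
    case-x i ei with i ≟ x
    ... | yes refl = at-x ei
    ... | no i≢x = follows i ei i≢x

  complete-scenario-∃ : ∀ {σ x t} (∃x : Q x ≡ ∃q) → FollowsOff σ x t → lookup t x ≡ s σ x ∃x t → Scenario φ σ t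
  complete-scenario-∃ {σ} {x} {t} ∃x off at-x =
    complete-scenario off λ ex → trans at-x (cong (λ p → s σ x p t) (uip ∃x ex))

  follows-update : ∀ {σ x t v} → Q x ≡ ∃q → FollowsOff σ x t → v ∈ D x → FollowsOff σ x (t [ x := v ])
  follows-update {σ} {x} {t} {v} ∃x (following t∈D follows) v∈D =
    following (InDom-update t x t∈D v∈D) λ i ei i≢x →
      trans (lookup∘update′ i≢x t v) (trans (follows i ei i≢x) (sym (choice-ignores σ ∃x i ei t∈D v∈D)))

  Origin : Strategy φ → Fin n → Fin d → Fin d → Tuple d n → Set
  Origin σ x c e t = Σ (Tuple d n) λ u → Scenario φ σ u × (t ≡ u ⊎ (lookup u x ≡ c × t ≡ u [ x := e ]))

  record Repair (σ : Strategy φ) (x : Fin n) (c e : Fin d) : Set where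
    field
      repaired : Strategy φ
      origin : ∀ t → Scenario φ repaired t → Origin σ x c e t
      image : ∀ t → Scenario φ σ t → lookup t x ≡ c → Scenario φ repaired (t [ x := e ])

  -- For existential x: post-compose the choice at x with replace c e.
  module RepairExistential (σ : Strategy φ) {x} (∃x : Q x ≡ ∃q) (c e : Fin d) (e∈D : e ∈ D x) where

    choice : (i : Fin n) → Q i ≡ ∃q → Tuple d n → Fin d
    choice i ei u with i ≟ x
    ... | yes refl = replace c e (s σ x ei u)
    ... | no _ = s σ i ei u

    choice-at : ∀ ex u → choice x ex u ≡ replace c e (s σ x ∃x u)
    choice-at ex u with x ≟ x
    ... | yes refl = cong (λ p → replace c e (s σ x p u)) (uip ex ∃x)
    ... | no x≢x = contradiction refl x≢x

    choice-off : ∀ i ei u → ¬ i ≡ x → choice i ei u ≡ s σ i ei u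
    choice-off i ei u i≢x with i ≟ x
    ... | yes i≡x = contradiction i≡x i≢x
    ... | no _ = refl

    σ' : Strategy φ
    σ' = record { s = choice ; s-dom = choice-dom ; s-fact = choice-fact }
      where
      choice-dom : ∀ i ei u → InDom φ u → choice i ei u ∈ D i
      choice-dom i ei u u∈D with i ≟ x
      ... | yes refl = replace-∈ c (s-dom σ x ei u u∈D) e∈D
      ... | no _ = s-dom σ i ei u u∈D
      choice-fact : ∀ i ei u u' → InDom φ u → InDom φ u' →
        restrict (Aprev φ i) u ≡ restrict (Aprev φ i) u' → choice i ei u ≡ choice i ei u'
      choice-fact i ei u u' u∈D u'∈D r with i ≟ x
      ... | yes refl = cong (replace c e) (s-fact σ x ei u u' u∈D u'∈D r)
      ... | no _ = s-fact σ i ei u u' u∈D u'∈D r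

    follows-σ : ∀ {t} → FollowsOff σ' x t → FollowsOff σ x t
    follows-σ (following t∈D follows) = following t∈D λ i ei i≢x → trans (follows i ei i≢x) (choice-off i ei _ i≢x)

    follows-σ' : ∀ {t} → FollowsOff σ x t → FollowsOff σ' x t
    follows-σ' (following t∈D follows) = following t∈D λ i ei i≢x → trans (follows i ei i≢x) (sym (choice-off i ei _ i≢x))

    -- A scenario t of σ' comes from the scenario of σ obtained by restoring σ's choice v at x.
    origin : ∀ t → Scenario φ σ' t → Origin σ x c e t
    origin t sc with s σ x ∃x t ≟ c
    ... | yes v≡c = u , complete-scenario-∃ ∃x u-off u-at-x , inj₂ (u-x , sym (update-restore t x c t-x))
      where
      t∈D = proj₁ sc
      c∈D : c ∈ D x
      c∈D = subst (_∈ D x) v≡c (s-dom σ x ∃x t t∈D)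
      u = t [ x := c ]
      u-off = follows-update ∃x (follows-σ (scenario-follows sc)) c∈D
      u-x : lookup u x ≡ c
      u-x = lookup∘update x t c
      t-x : lookup t x ≡ e
      t-x = trans (proj₂ sc x ∃x) (trans (choice-at ∃x t) (trans (cong (replace c e) v≡c) (replace-hit c e)))
      u-at-x : lookup u x ≡ s σ x ∃x u
      u-at-x = trans u-x (trans (sym v≡c) (sym (choice-ignores σ ∃x x ∃x t∈D c∈D)))
    ... | no v≢c = t , complete-scenario-∃ ∃x (follows-σ (scenario-follows sc)) t-at-x , inj₁ refl
      where
      t-at-x : lookup t x ≡ s σ x ∃x t
      t-at-x = trans (proj₂ sc x ∃x) (trans (choice-at ∃x t) (replace-miss e v≢c))

    image : ∀ t → Scenario φ σ t → lookup t x ≡ c → Scenario φ σ' (t [ x := e ])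
    image t sc t-x = complete-scenario (follows-σ' (follows-update ∃x (scenario-follows sc) e∈D)) at-x
      where
      at-x : ∀ ex → lookup (t [ x := e ]) x ≡ choice x ex (t [ x := e ])
      at-x ex = begin
        lookup (t [ x := e ]) x                ≡⟨ lookup∘update x t e ⟩
        e                                      ≡⟨ sym (replace-hit c e) ⟩
        replace c e c                          ≡⟨ cong (replace c e) (trans (sym t-x) (proj₂ sc x ∃x)) ⟩
        replace c e (s σ x ∃x t)               ≡⟨ cong (replace c e) (sym (choice-ignores σ ∃x x ∃x (proj₁ sc) e∈D)) ⟩
        replace c e (s σ x ∃x (t [ x := e ]))  ≡⟨ sym (choice-at ex _) ⟩
        choice x ex (t [ x := e ])             ∎
        where open ≡-Reasoning

    repair : Repair σ x c e
    repair = record { repaired = σ' ; origin = origin ; image = image }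

  -- For universal x: answer the adversary's move e at x as σ answers the move c.
  module RepairUniversal (σ : Strategy φ) {x} (∀x : Q x ≡ ∀q) (c e : Fin d) (c∈D : c ∈ D x) (e∈D : e ∈ D x) where

    redirect : Tuple d n → Tuple d n
    redirect u = u [ x := replace e c (lookup u x) ]

    σ' : Strategy φ
    σ' = record
      { s = λ i ei u → s σ i ei (redirect u)
      ; s-dom = λ i ei u u∈D → s-dom σ i ei _ (InDom-update u x u∈D (replace-∈ e (u∈D x) c∈D))
      ; s-fact = λ i ei u u' u∈D u'∈D r →
          s-fact σ i ei _ _ (InDom-update u x u∈D (replace-∈ e (u∈D x) c∈D)) (InDom-update u' x u'∈D (replace-∈ e (u'∈D x) c∈D))
                 (restrict-update-local (Aprev φ i) u u' x (replace e c) r)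
      }

    existential-≢ : ∀ {i} → Q i ≡ ∃q → ¬ i ≡ x
    existential-≢ ei refl with trans (sym ei) ∀x
    ... | ()

    -- Redirecting only touches the universal variable x, hence no scenario condition.
    redirect-scenario : ∀ t → Scenario φ σ' t → Scenario φ σ (redirect t)
    redirect-scenario t (t∈D , follows) =
      complete-scenario {σ} {x} {redirect t}
        (following (InDom-update t x t∈D (replace-∈ e (t∈D x) c∈D)) λ i ei i≢x → trans (lookup∘update′ i≢x t _) (follows i ei))
        (λ ex → contradiction refl (existential-≢ ex))

    redirect-relation : ∀ t → t ≡ redirect t ⊎ (lookup (redirect t) x ≡ c × t ≡ redirect t [ x := e ])
    redirect-relation t = by-cases (lookup t x ≟ e)
      where
      by-cases : Dec (lookup t x ≡ e) → t ≡ redirect t ⊎ (lookup (redirect t) x ≡ c × t ≡ redirect t [ x := e ])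
      by-cases (yes t-x) = inj₂ (trans (lookup∘update x t _) (trans (cong (replace e c) t-x) (replace-hit e c))
                                , sym (update-restore t x _ t-x))
      by-cases (no t-x≢e) = inj₁ (sym (trans (cong (t [ x ]≔_) (replace-miss c t-x≢e)) ([]≔-lookup t x)))

    origin : ∀ t → Scenario φ σ' t → Origin σ x c e t
    origin t sc = redirect t , redirect-scenario t sc , redirect-relation t

    image : ∀ t → Scenario φ σ t → lookup t x ≡ c → Scenario φ σ' (t [ x := e ])
    image t (t∈D , follows) t-x =
      InDom-update t x t∈D e∈D , λ i ei → begin
        lookup (t [ x := e ]) i             ≡⟨ lookup∘update′ (existential-≢ ei) t e ⟩
        lookup t i                          ≡⟨ follows i ei ⟩
        s σ i ei t                          ≡⟨ cong (s σ i ei) (sym (update-restore t x e t-x)) ⟩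
        s σ i ei ((t [ x := e ]) [ x := c ]) ≡⟨ cong (λ v → s σ i ei ((t [ x := e ]) [ x := v ])) (sym redirected) ⟩
        s σ i ei (redirect (t [ x := e ]))  ∎
      where
      open ≡-Reasoning
      redirected : replace e c (lookup (t [ x := e ]) x) ≡ c
      redirected = trans (cong (replace e c) (lookup∘update x t e)) (replace-hit e c)

    repair : Repair σ x c e
    repair = record { repaired = σ' ; origin = origin ; image = image }

  repair-exists : ∀ σ x c e → e ∈ D x → ∀ t → Scenario φ σ t → lookup t x ≡ c → Repair σ x c e
  repair-exists σ x c e e∈D t (t∈D , _) t-x with Q x in qx
  ... | ∃q = RepairExistential.repair σ qx c e e∈D
  ... | ∀q = RepairUniversal.repair σ qx c e (subst (_∈ D x) t-x (t∈D x)) e∈D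

  substitution-principle : ∀ x c e → e ∈ D x →
    (∀ t → out φ t → lookup t x ≡ c → sol φ (t [ x := e ])) → d-substitutable φ x c e
  substitution-principle x c e e∈D solves t (σ , σ-wins , sc) t-x =
    repaired , wins , image t sc t-x
    where
    open Repair (repair-exists σ x c e e∈D t sc t-x)
    wins : Winning φ repaired
    wins t' sc' with origin t' sc'
    ... | u , u-sc , inj₁ refl = σ-wins u u-sc
    ... | u , u-sc , inj₂ (u-x , refl) = solves u (σ , σ-wins , u-sc) u-x

  -- A winning strategy of φ also wins φ_k, whose only constraint is c_k.
  out-single : ∀ k t → out φ t → out (single φ k) t
  out-single k t (σ , σ-wins , sc) = σ' , (λ t' sc' _ → σ-wins t' sc' k) , sc
    where
    σ' : Strategy (single φ k)
    σ' = record { s = s σ ; s-dom = s-dom σ ; s-fact = s-fact σ }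

  sol-from-singles : ∀ t → (∀ k → out (single φ k) t) → sol φ t
  sol-from-singles t outs k with outs k
  ... | σ , σ-wins , sc = σ-wins t sc zero

  substitutable-from-singles : ∀ x a b → b ∈ D x →
    (∀ k → d-substitutable (single φ k) x a b) → d-substitutable φ x a b
  substitutable-from-singles x a b b∈D subs =
    substitution-principle x a b b∈D λ t o t-x → sol-from-singles _ λ k → subs k t (out-single k t o) t-x

  -- Fixability is substitutability of a by the current value, for every value.
  fixable-from-singles : ∀ x a → a ∈ D x → (∀ k → d-fixable (single φ k) x a) → d-fixable φ x a
  fixable-from-singles x a a∈D fixes t o =
    substitutable-from-singles x (lookup t x) a a∈D (λ k t' o' _ → fixes k t' o') t o refl

module _ {d n : ℕ} {φ ψ : QCSP d n} (fewer : ∀ t → out φ t → out ψ t) where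

  inconsistent-⊆ : ∀ x a → inconsistent ψ x a → inconsistent φ x a
  inconsistent-⊆ x a h t o = h t (fewer t o)

  implied-⊆ : ∀ x a → implied ψ x a → implied φ x a
  implied-⊆ x a h t o = h t (fewer t o)

  determined-⊆ : ∀ x → determined ψ x → determined φ x
  determined-⊆ x h t o b b≢ o' = h t (fewer t o) b b≢ (fewer _ o')

  dependent-⊆ : ∀ V x → dependent ψ V x → dependent φ V x
  dependent-⊆ V x h t t' o o' r = h t t' (fewer t o) (fewer t' o') r

proposition14 : (d n : ℕ) (φ : QCSP d n) (x : Fin n) (V : Subset n) (a b : Fin d) →
    a ∈ QCSP.D φ x → b ∈ QCSP.D φ x →
    (Σ (Fin (QCSP.m φ)) (λ k → inconsistent (single φ k) x a) → inconsistent φ x a)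
    × (Σ (Fin (QCSP.m φ)) (λ k → implied (single φ k) x a) → implied φ x a)
    × (((k : Fin (QCSP.m φ)) → d-fixable (single φ k) x a) → d-fixable φ x a)
    × (((k : Fin (QCSP.m φ)) → d-substitutable (single φ k) x a b) → d-substitutable φ x a b)
    × (((k : Fin (QCSP.m φ)) → d-interchangeable (single φ k) x a b) → d-interchangeable φ x a b)
    × (Σ (Fin (QCSP.m φ)) (λ k → determined (single φ k) x) → determined φ x)
    × (((k : Fin (QCSP.m φ)) → d-irrelevant (single φ k) x) → d-irrelevant φ x)
    × (Σ (Fin (QCSP.m φ)) (λ k → dependent (single φ k) V x) → dependent φ V x)
proposition14 d n φ x V a b a∈D b∈D =
    (λ { (k , h) → inconsistent-⊆ (out-single φ k) x a h })
  , (λ { (k , h) → implied-⊆ (out-single φ k) x a h })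
  , fixable-from-singles φ x a a∈D
  , substitutable-from-singles φ x a b b∈D
  , (λ hs → substitutable-from-singles φ x a b b∈D (λ k → proj₁ (hs k))
          , substitutable-from-singles φ x b a a∈D (λ k → proj₂ (hs k)))
  , (λ { (k , h) → determined-⊆ (out-single φ k) x h })
  , (λ hs t o c c∈D → fixable-from-singles φ x c c∈D (λ k t' o' → hs k t' o' c c∈D) t o)
  , (λ { (k , h) → dependent-⊆ (out-single φ k) V x h })
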